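{- If $G$ is a connected bipartite graph with at least two vertices that has a Hamiltonian path, then $F(G \,\square\, K_2) = \alpha(G \,\square\, K_2) - 1$.
   Context: Peg solitaire on a graph: a configuration assigns to each vertex either a peg or a hole. If $x,y,z$ form a path $xyz$ with pegs at $x$ and $y$ and a hole at $z$, a jump $xyz$ removes the pegs at $x$ and $y$ and places a peg at $z$. A terminal state of a graph $G$ is the set of peg locations when no jump is available, reached by some sequence of jumps from a starting configuration with exactly one hole (and pegs on all other vertices). The fool's solitaire number $F(G)$ is the maximum size of a terminal state of $G$. $\alpha$ is the independence number. The cartesian product $G \,\square\, H$ has vertex set $V(G)\times V(H)$, two vertices being adjacent iff they are equal in one coordinate and adjacent in the other. -}

module Defs where

open import Data.Nat using (ℕ; zero; suc; _*_; _≤_)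
open import Data.Fin using (Fin; toℕ; combine; remQuot)
open import Data.Fin.Subset using (Subset; _∈_; _∉_; ∣_∣; ∁; ⁅_⁆; inside; outside)
open import Data.Fin.Permutation using (Permutation′; _⟨$⟩ʳ_)
open import Data.Vec using (_[_]≔_)
open import Data.Product using (Σ; ∃; _×_; _,_; proj₁; proj₂)
open import Data.Sum using (_⊎_; inj₁; inj₂)
open import Data.Bool using (Bool)
open import Relation.Binary.PropositionalEquality using (_≡_; _≢_; refl)
open import Relation.Binary.Construct.Closure.ReflexiveTransitive using (Star)
open import Relation.Nullary using (¬_)

record Graph (n : ℕ) : Set₁ where
  field
    Adj    : Fin n → Fin n → Set
    adj-sym    : ∀ {u v} → Adj u v → Adj v u
    adj-irrefl : ∀ {u} → ¬ Adj u u
open Graph public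

K : (n : ℕ) → Graph n
K n = record { Adj = λ i j → i ≢ j ; adj-sym = λ p q → p (Relation.Binary.PropositionalEquality.sym q) ; adj-irrefl = λ p → p refl }

-- Cartesian product G □ H; the vertex (a , b) ∈ V(G) × V(H) is encoded as combine a b.
ProdAdj : ∀ {m n} → Graph m → Graph n → Fin (m * n) → Fin (m * n) → Set
ProdAdj {m} {n} G H u v =
  let (a , b) = remQuot {m} n u
      (c , d) = remQuot {m} n v
  in (a ≡ c × Adj H b d) ⊎ (Adj G a c × b ≡ d)

_□_ : ∀ {m n} → Graph m → Graph n → Graph (m * n)
_□_ {m} {n} G H = record { Adj = ProdAdj G H ; adj-sym = s ; adj-irrefl = i }
  where
    s : ∀ {u v} → ProdAdj G H u v → ProdAdj G H v u
    s (inj₁ (p , q)) = inj₁ (Relation.Binary.PropositionalEquality.sym p , Graph.adj-sym H q)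
    s (inj₂ (p , q)) = inj₂ (Graph.adj-sym G p , Relation.Binary.PropositionalEquality.sym q)
    i : ∀ {u} → ¬ ProdAdj G H u u
    i (inj₁ (_ , q)) = Graph.adj-irrefl H q
    i (inj₂ (p , _)) = Graph.adj-irrefl G p

Connected : ∀ {n} → Graph n → Set
Connected {n} G = ∀ (u v : Fin n) → Star (Adj G) u v

Bipartite : ∀ {n} → Graph n → Set
Bipartite {n} G = Σ (Fin n → Bool) λ c → ∀ {u v} → Adj G u v → c u ≢ c v

HasHamiltonianPath : ∀ {n} → Graph n → Set
HasHamiltonianPath {n} G =
  Σ (Permutation′ n) λ σ → ∀ (i j : Fin n) → toℕ j ≡ suc (toℕ i) → Adj G (σ ⟨$⟩ʳ i) (σ ⟨$⟩ʳ j)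

Independent : ∀ {n} → Graph n → Subset n → Set
Independent G S = ∀ {u v} → u ∈ S → v ∈ S → ¬ Adj G u v

IsIndependenceNumber : ∀ {n} → Graph n → ℕ → Set
IsIndependenceNumber {n} G a =
  (Σ (Subset n) λ S → Independent G S × ∣ S ∣ ≡ a) ×
  (∀ (S : Subset n) → Independent G S → ∣ S ∣ ≤ a)

-- Peg solitaire: a configuration is the set of vertices carrying a peg.
-- A jump xyz along the path xyz (x ≠ z) with pegs at x, y and a hole at z.
data Jump {n} (G : Graph n) : Subset n → Subset n → Set where
  jump : ∀ {p} (x y z : Fin n) → Adj G x y → Adj G y z → x ≢ z →
         x ∈ p → y ∈ p → z ∉ p →
         Jump G p (((p [ x ]≔ outside) [ y ]≔ outside) [ z ]≔ inside)

NoJump : ∀ {n} → Graph n → Subset n → Set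
NoJump {n} G p = ∀ (q : Subset n) → ¬ Jump G p q

TerminalState : ∀ {n} → Graph n → Subset n → Set
TerminalState {n} G p =
  Σ (Fin n) (λ h → Star (Jump G) (∁ ⁅ h ⁆) p) × NoJump G p

IsFoolsSolitaireNumber : ∀ {n} → Graph n → ℕ → Set
IsFoolsSolitaireNumber {n} G k =
  (Σ (Subset n) λ p → TerminalState G p × ∣ p ∣ ≡ k) ×
  (∀ (p : Subset n) → TerminalState G p → ∣ p ∣ ≤ k)

module Submission where

-- In a connected graph every terminal state is independent: from two adjacent pegs, walk towards
-- a hole; the first hole met on the walk is the landing cell of a jump. An independent set of
-- G □ K₂ meets each fibre {v} × K₂ at most once, so α(G □ K₂) = |V(G)|, attained by the
-- checkerboard of a 2-colouring. The last jump of a game leaves two adjacent holes, and by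
-- independence these force an empty fibre, so F ≤ α − 1 (a game without jumps ends at the start,
-- which is far too large to be independent). Conversely, list V(G) along a Hamiltonian path.
-- Two opening jumps empty the fibre of the second vertex and leave the checkerboard peg on the
-- first; then each jump (v_{k+1}, ·) → (v_{k+1}, ·) → (v_k, ·) moves the empty fibre one step
-- along the path with the checkerboard behind it. Once the last fibre is empty, the |V(G)| − 1
-- remaining pegs lie on the checkerboard, so no jump is possible.

open import Defs
open import Data.Nat using (ℕ; zero; suc; _+_; _*_; _∸_; _≤_; _<_; z≤n; s≤s; s≤s⁻¹)
open import Data.Nat.Properties
  using (≤-refl; ≤-trans; ≤-antisym; n≤1+n; n<1+n; m≤n⇒m≤1+n; m<n⇒m<1+n; <⇒≱; ≤∧≢⇒<; n≢0⇒n>0;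
         m≤m*n; +-suc; +-cancelˡ-≡)
open import Data.Fin using (Fin; zero; suc; toℕ; fromℕ<; combine; remQuot)
open import Data.Fin.Patterns using (0F; 1F)
open import Data.Fin.Properties
  using (_≟_; combine-remQuot; remQuot-combine; combine-injectiveˡ; combine-injectiveʳ;
         toℕ-injective; toℕ-fromℕ<; toℕ<n; 2↔Bool)
open import Data.Fin.Subset using (Subset; Side; inside; outside; _∈_; _∉_; _⊆_; ∣_∣; ∁; ⁅_⁆)
open import Data.Fin.Subset.Properties
  using (_∈?_; drop-there; x∈⁅x⁆; x∈⁅y⁆⇒x≡y; x∈p⇒x∉∁p; x∉p⇒x∈∁p; ∣∁p∣≡n∸∣p∣; ∣⁅x⁆∣≡1; ∣p∣≤∣x∷p∣)
open import Data.Fin.Permutation using (Permutation′; _⟨$⟩ʳ_; _⟨$⟩ˡ_; inverseˡ; inverseʳ)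
open import Data.Vec using ([]; _∷_; lookup; tabulate; _[_]≔_; here; there)
open import Data.Vec.Properties
  using (lookup∘update; lookup∘update′; lookup∘tabulate; tabulate∘lookup; tabulate-cong;
         []=⇒lookup; lookup⇒[]=)
open import Data.Product using (∃; ∃₂; _×_; _,_; proj₁; proj₂; uncurry)
open import Data.Sum using (_⊎_; inj₁; inj₂)
open import Function using (_∘_; Inverse)
open import Relation.Binary.PropositionalEquality
  using (_≡_; _≢_; refl; sym; trans; cong; subst; subst₂; module ≡-Reasoning)
open import Relation.Binary.Construct.Closure.ReflexiveTransitive using (Star; ε; _◅_; _◅◅_; gmap)
open import Relation.Nullary using (¬_; yes; no; does; contradiction)
open import Relation.Nullary.Decidable using (dec-true; dec-false)
open import Data.Nat.Tactic.RingSolver using (solve-∀)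

lookup-ext : ∀ {N} {p q : Subset N} → (∀ u → lookup p u ≡ lookup q u) → p ≡ q
lookup-ext {p = p} {q} eq =
  trans (sym (tabulate∘lookup p)) (trans (tabulate-cong eq) (tabulate∘lookup q))

lookup≡outside⇒∉ : ∀ {N} {p : Subset N} {u} → lookup p u ≡ outside → u ∉ p
lookup≡outside⇒∉ eq u∈p with trans (sym ([]=⇒lookup u∈p)) eq
... | ()

∉⇒lookup≡outside : ∀ {N} {p : Subset N} {u} → u ∉ p → lookup p u ≡ outside
∉⇒lookup≡outside {p = p} {u} u∉p with lookup p u in eq
... | inside  = contradiction (lookup⇒[]= u p eq) u∉p
... | outside = refl

∣p[u]≔outside∣ : ∀ {N} (p : Subset N) u → lookup p u ≡ inside → suc ∣ p [ u ]≔ outside ∣ ≡ ∣ p ∣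
∣p[u]≔outside∣ (inside  ∷ p) zero    _  = refl
∣p[u]≔outside∣ (outside ∷ p) zero    ()
∣p[u]≔outside∣ (inside  ∷ p) (suc u) eq = cong suc (∣p[u]≔outside∣ p u eq)
∣p[u]≔outside∣ (outside ∷ p) (suc u) eq = ∣p[u]≔outside∣ p u eq

∣p[u]≔inside∣ : ∀ {N} (p : Subset N) u → lookup p u ≡ outside → ∣ p [ u ]≔ inside ∣ ≡ suc ∣ p ∣
∣p[u]≔inside∣ (inside  ∷ p) zero    ()
∣p[u]≔inside∣ (outside ∷ p) zero    _  = refl
∣p[u]≔inside∣ (inside  ∷ p) (suc u) eq = cong suc (∣p[u]≔inside∣ p u eq)
∣p[u]≔inside∣ (outside ∷ p) (suc u) eq = ∣p[u]≔inside∣ p u eq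

x≢y⇒x∈∁⁅y⁆ : ∀ {N} {x y : Fin N} → x ≢ y → x ∈ ∁ ⁅ y ⁆
x≢y⇒x∈∁⁅y⁆ {y = y} x≢y = x∉p⇒x∈∁p (x≢y ∘ x∈⁅y⁆⇒x≡y y)

x∉∁⁅x⁆ : ∀ {N} (x : Fin N) → x ∉ ∁ ⁅ x ⁆
x∉∁⁅x⁆ x = x∈p⇒x∉∁p (x∈⁅x⁆ x)

∣∁⁅x⁆∣≡n∸1 : ∀ {N} (x : Fin N) → ∣ ∁ ⁅ x ⁆ ∣ ≡ N ∸ 1
∣∁⁅x⁆∣≡n∸1 {N} x = trans (∣∁p∣≡n∸∣p∣ ⁅ x ⁆) (cong (N ∸_) (∣⁅x⁆∣≡1 x))

ε-or-last : ∀ {a ℓ} {A : Set a} {R : A → A → Set ℓ} {i j} → Star R i j → i ≡ j ⊎ ∃ λ k → R k j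
ε-or-last ε = inj₁ refl
ε-or-last (r ◅ rs) with ε-or-last rs
... | inj₁ refl = inj₂ (_ , r)
... | inj₂ last = inj₂ last

adj⇒≢ : ∀ {N} (H : Graph N) {u v} → Adj H u v → u ≢ v
adj⇒≢ H uv refl = adj-irrefl H uv

jumped : ∀ {N} → Subset N → Fin N → Fin N → Fin N → Subset N
jumped p x y z = ((p [ x ]≔ outside) [ y ]≔ outside) [ z ]≔ inside

module _ {N} (p : Subset N) (x y z : Fin N) where

  private
    p₁ p₂ : Subset N
    p₁ = p [ x ]≔ outside
    p₂ = p₁ [ y ]≔ outside

  lookup-jumped-z : lookup (jumped p x y z) z ≡ inside
  lookup-jumped-z = lookup∘update z p₂ inside

  lookup-jumped-y : y ≢ z → lookup (jumped p x y z) y ≡ outside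
  lookup-jumped-y y≢z = trans (lookup∘update′ y≢z p₂ inside) (lookup∘update y p₁ outside)

  lookup-jumped-x : x ≢ y → x ≢ z → lookup (jumped p x y z) x ≡ outside
  lookup-jumped-x x≢y x≢z =
    trans (lookup∘update′ x≢z p₂ inside)
          (trans (lookup∘update′ x≢y p₁ outside) (lookup∘update x p outside))

  lookup-jumped-other : ∀ {u} → u ≢ x → u ≢ y → u ≢ z → lookup (jumped p x y z) u ≡ lookup p u
  lookup-jumped-other u≢x u≢y u≢z =
    trans (lookup∘update′ u≢z p₂ inside)
          (trans (lookup∘update′ u≢y p₁ outside) (lookup∘update′ u≢x p outside))

module _ {N} {H : Graph N} where

  jump-intro : ∀ {p q : Subset N} {x y z} → Adj H x y → Adj H y z → x ≢ z →
    lookup p x ≡ inside → lookup p y ≡ inside → lookup p z ≡ outside →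
    lookup q x ≡ outside → lookup q y ≡ outside → lookup q z ≡ inside →
    (∀ u → u ≢ x → u ≢ y → u ≢ z → lookup q u ≡ lookup p u) → Jump H p q
  jump-intro {p} {q} {x} {y} {z} xy yz x≢z px py pz qx qy qz qu =
    subst (Jump H p) (sym (lookup-ext q≗jumped))
      (jump x y z xy yz x≢z (lookup⇒[]= x p px) (lookup⇒[]= y p py) (lookup≡outside⇒∉ pz))
    where
    q≗jumped : ∀ u → lookup q u ≡ lookup (jumped p x y z) u
    q≗jumped u with u ≟ z | u ≟ y | u ≟ x
    ... | yes refl | _        | _        = trans qz (sym (lookup-jumped-z p x y z))
    ... | no u≢z   | yes refl | _        = trans qy (sym (lookup-jumped-y p x y z u≢z))
    ... | no u≢z   | no u≢y   | yes refl = trans qx (sym (lookup-jumped-x p x y z u≢y u≢z))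
    ... | no u≢z   | no u≢y   | no u≢x   =
      trans (qu u u≢x u≢y u≢z) (sym (lookup-jumped-other p x y z u≢x u≢y u≢z))

  jump-size : ∀ {p q} → Jump H p q → suc ∣ q ∣ ≡ ∣ p ∣
  jump-size {p} (jump x y z xy yz x≢z x∈p y∈p z∉p) = begin
    suc ∣ p₂ [ z ]≔ inside ∣  ≡⟨ cong suc (∣p[u]≔inside∣ p₂ z p₂[z]) ⟩
    suc (suc ∣ p₂ ∣)          ≡⟨ cong suc (∣p[u]≔outside∣ p₁ y p₁[y]) ⟩
    suc ∣ p₁ ∣                ≡⟨ ∣p[u]≔outside∣ p x ([]=⇒lookup x∈p) ⟩
    ∣ p ∣                     ∎
    where
    open ≡-Reasoning
    p₁ p₂ : Subset N
    p₁ = p [ x ]≔ outside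
    p₂ = p₁ [ y ]≔ outside
    p₁[y] : lookup p₁ y ≡ inside
    p₁[y] = trans (lookup∘update′ (adj⇒≢ H xy ∘ sym) p outside) ([]=⇒lookup y∈p)
    p₂[z] : lookup p₂ z ≡ outside
    p₂[z] = trans (lookup∘update′ (adj⇒≢ H yz ∘ sym) p₁ outside)
                  (trans (lookup∘update′ (x≢z ∘ sym) p outside) (∉⇒lookup≡outside z∉p))

  jump-vacates : ∀ {p q} → Jump H p q → ∃₂ λ x y → Adj H x y × x ∉ q × y ∉ q
  jump-vacates {p} (jump x y z xy yz x≢z _ _ _) =
    x , y , xy , lookup≡outside⇒∉ (lookup-jumped-x p x y z (adj⇒≢ H xy) x≢z)
               , lookup≡outside⇒∉ (lookup-jumped-y p x y z (adj⇒≢ H yz))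

  reachable-has-hole : ∀ {h q} → Star (Jump H) (∁ ⁅ h ⁆) q → ∃ λ u → u ∉ q
  reachable-has-hole {h} play with ε-or-last play
  ... | inj₁ refl    = h , x∉∁⁅x⁆ h
  ... | inj₂ (_ , j) = let (x , _ , _ , x∉q , _) = jump-vacates j in x , x∉q

  walk-to-hole⇒jump : ∀ {p : Subset N} {x y h} → Star (Adj H) y h →
    x ∈ p → y ∈ p → Adj H x y → h ∉ p → ∃ (Jump H p)
  walk-to-hole⇒jump ε _ y∈p _ h∉p = contradiction y∈p h∉p
  walk-to-hole⇒jump {p} {x} {y} (_◅_ {j = w} yw walk) x∈p y∈p xy h∉p with w ∈? p
  ... | yes w∈p = walk-to-hole⇒jump walk y∈p w∈p yw h∉p
  ... | no  w∉p = _ , jump x y w xy yw (λ { refl → w∉p x∈p }) x∈p y∈p w∉p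

  terminal⇒independent : ∀ {T} → Connected H → TerminalState H T → Independent H T
  terminal⇒independent conn ((_ , play) , noJump) x∈T y∈T xy with reachable-has-hole play
  ... | h , h∉T = let (_ , j) = walk-to-hole⇒jump (conn _ h) x∈T y∈T xy h∉T in noJump _ j

  independent⇒noJump : ∀ {p} → Independent H p → NoJump H p
  independent⇒noJump ind _ (jump x y z xy _ _ x∈p y∈p _) = ind x∈p y∈p xy

data IsPair {m n} : Fin (m * n) → Set where
  pair : (a : Fin m) (b : Fin n) → IsPair (combine a b)

pair-view : ∀ {m n} (u : Fin (m * n)) → IsPair {m} {n} u
pair-view {m} {n} u = subst IsPair (combine-remQuot {m} n u) (pair _ _)

module _ {m n} {G : Graph m} {H : Graph n} where

  private
    PairAdj : Fin m × Fin n → Fin m × Fin n → Set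
    PairAdj (a , b) (c , d) = (a ≡ c × Adj H b d) ⊎ (Adj G a c × b ≡ d)

  □-adj-cases : ∀ {a b c d} → Adj (G □ H) (combine a b) (combine c d) →
    (a ≡ c × Adj H b d) ⊎ (Adj G a c × b ≡ d)
  □-adj-cases {a} {b} {c} {d} = subst₂ PairAdj (remQuot-combine a b) (remQuot-combine c d)

  □-adj-intro : ∀ {a b c d} → (a ≡ c × Adj H b d) ⊎ (Adj G a c × b ≡ d) →
    Adj (G □ H) (combine a b) (combine c d)
  □-adj-intro {a} {b} {c} {d} = subst₂ PairAdj (sym (remQuot-combine a b)) (sym (remQuot-combine c d))

  □-adjˡ : ∀ {a c} b → Adj G a c → Adj (G □ H) (combine a b) (combine c b)
  □-adjˡ {a} {c} b ac = □-adj-intro {a} {b} {c} {b} (inj₂ (ac , refl))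

  □-adjʳ : ∀ a {b d} → Adj H b d → Adj (G □ H) (combine a b) (combine a d)
  □-adjʳ a {b} {d} bd = □-adj-intro {a} {b} {a} {d} (inj₁ (refl , bd))

  □-connected : Connected G → Connected H → Connected (G □ H)
  □-connected connG connH u w with pair-view {m} {n} u | pair-view {m} {n} w
  ... | pair a b | pair c d =
    gmap (λ x → combine x b) (□-adjˡ b) (connG a c) ◅◅ gmap (combine c) (□-adjʳ c) (connH b d)

K-connected : ∀ n → Connected (K n)
K-connected n u v with u ≟ v
... | yes refl = ε
... | no  u≢v  = u≢v ◅ ε

combine-≢ˡ : ∀ {m n} {a c : Fin m} {b d : Fin n} → a ≢ c → combine a b ≢ combine c d
combine-≢ˡ {a = a} {c} {b} {d} a≢c = a≢c ∘ combine-injectiveˡ a b c d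

combine-≢ʳ : ∀ {m n} (a : Fin m) {b d : Fin n} → b ≢ d → combine a b ≢ combine a d
combine-≢ʳ a {b} {d} b≢d = b≢d ∘ combine-injectiveʳ a b a d

K2-cover : ∀ {b d : Fin 2} → b ≢ d → ∀ e → e ≡ b ⊎ e ≡ d
K2-cover {0F} {0F} b≢d _  = contradiction refl b≢d
K2-cover {1F} {1F} b≢d _  = contradiction refl b≢d
K2-cover {0F} {1F} _   0F = inj₁ refl
K2-cover {0F} {1F} _   1F = inj₂ refl
K2-cover {1F} {0F} _   0F = inj₂ refl
K2-cover {1F} {0F} _   1F = inj₁ refl

K2-other : ∀ (b : Fin 2) → ∃ λ d → b ≢ d
K2-other 0F = 1F , λ ()
K2-other 1F = 0F , λ ()

-- combine v b is the index 2v + b, so each fibre {v} × K₂ is a pair of consecutive entries of the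
-- vector; the counting lemmas below consume the vector two entries at a time.
AtMostOnePerFibre : ∀ {n} → Subset (n * 2) → Set
AtMostOnePerFibre {n} p = ∀ (v : Fin n) {b d : Fin 2} → combine v b ∈ p → combine v d ∈ p → b ≡ d

HasEmptyFibre : ∀ {n} → Subset (n * 2) → Set
HasEmptyFibre {n} p = ∃ λ (v : Fin n) → ∀ (b : Fin 2) → combine v b ∉ p

MeetsEveryFibre : ∀ {n} → Subset (n * 2) → Set
MeetsEveryFibre {n} p = ∀ (v : Fin n) → ∃ λ (b : Fin 2) → combine v b ∈ p

atMostOne-tail : ∀ {n x y} {p : Subset (n * 2)} →
  AtMostOnePerFibre {suc n} (x ∷ y ∷ p) → AtMostOnePerFibre {n} p
atMostOne-tail one v vb∈p vd∈p = one (suc v) (there (there vb∈p)) (there (there vd∈p))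

atMostOne⇒∣p∣≤n : ∀ {n} (p : Subset (n * 2)) → AtMostOnePerFibre {n} p → ∣ p ∣ ≤ n
atMostOne⇒∣p∣≤n {zero}  []                      _   = z≤n
atMostOne⇒∣p∣≤n {suc n} (inside  ∷ inside  ∷ p) one =
  contradiction (one 0F {0F} {1F} here (there here)) λ ()
atMostOne⇒∣p∣≤n {suc n} (inside  ∷ outside ∷ p) one = s≤s (atMostOne⇒∣p∣≤n p (atMostOne-tail one))
atMostOne⇒∣p∣≤n {suc n} (outside ∷ inside  ∷ p) one = s≤s (atMostOne⇒∣p∣≤n p (atMostOne-tail one))
atMostOne⇒∣p∣≤n {suc n} (outside ∷ outside ∷ p) one = m≤n⇒m≤1+n (atMostOne⇒∣p∣≤n p (atMostOne-tail one))

atMostOne∧empty⇒∣p∣<n : ∀ {n} (p : Subset (n * 2)) →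
  AtMostOnePerFibre {n} p → HasEmptyFibre {n} p → ∣ p ∣ < n
atMostOne∧empty⇒∣p∣<n {suc n} (inside  ∷ inside  ∷ p) one _ =
  contradiction (one 0F {0F} {1F} here (there here)) λ ()
atMostOne∧empty⇒∣p∣<n {suc n} (inside  ∷ outside ∷ p) _   (0F , empty) = contradiction here (empty 0F)
atMostOne∧empty⇒∣p∣<n {suc n} (outside ∷ inside  ∷ p) _   (0F , empty) = contradiction (there here) (empty 1F)
atMostOne∧empty⇒∣p∣<n {suc n} (outside ∷ outside ∷ p) one (0F , _)     =
  s≤s (atMostOne⇒∣p∣≤n p (atMostOne-tail one))
atMostOne∧empty⇒∣p∣<n {suc n} (inside  ∷ outside ∷ p) one (suc v , empty) =
  s≤s (atMostOne∧empty⇒∣p∣<n p (atMostOne-tail one) (v , λ b → empty b ∘ there ∘ there))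
atMostOne∧empty⇒∣p∣<n {suc n} (outside ∷ inside  ∷ p) one (suc v , empty) =
  s≤s (atMostOne∧empty⇒∣p∣<n p (atMostOne-tail one) (v , λ b → empty b ∘ there ∘ there))
atMostOne∧empty⇒∣p∣<n {suc n} (outside ∷ outside ∷ p) one (suc v , empty) =
  m<n⇒m<1+n (atMostOne∧empty⇒∣p∣<n p (atMostOne-tail one) (v , λ b → empty b ∘ there ∘ there))

meetsEvery-tail : ∀ {n x y} {p : Subset (n * 2)} →
  MeetsEveryFibre {suc n} (x ∷ y ∷ p) → MeetsEveryFibre {n} p
meetsEvery-tail meets v = let (b , vb∈p) = meets (suc v) in b , drop-there (drop-there vb∈p)

meetsEvery⇒n≤∣p∣ : ∀ {n} (p : Subset (n * 2)) → MeetsEveryFibre {n} p → n ≤ ∣ p ∣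
meetsEvery⇒n≤∣p∣ {zero}  []                      _     = z≤n
meetsEvery⇒n≤∣p∣ {suc n} (inside  ∷ y       ∷ p) meets =
  s≤s (≤-trans (meetsEvery⇒n≤∣p∣ p (meetsEvery-tail meets)) (∣p∣≤∣x∷p∣ y p))
meetsEvery⇒n≤∣p∣ {suc n} (outside ∷ inside  ∷ p) meets =
  s≤s (meetsEvery⇒n≤∣p∣ p (meetsEvery-tail meets))
meetsEvery⇒n≤∣p∣ {suc n} (outside ∷ outside ∷ p) meets with meets 0F
... | 0F , ()
... | 1F , there ()

cells : ∀ {n} → (Fin n → Fin 2 → Side) → Subset (n * 2)
cells {n} f = tabulate (uncurry f ∘ remQuot {n} 2)

lookup-cells : ∀ {n} (f : Fin n → Fin 2 → Side) v b → lookup (cells f) (combine v b) ≡ f v b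
lookup-cells {n} f v b =
  trans (lookup∘tabulate (uncurry f ∘ remQuot {n} 2) (combine v b))
        (cong (uncurry f) (remQuot-combine v b))

module _ {n} (G : Graph n) where

  □K2-rung : ∀ v {b d : Fin 2} → b ≢ d → Adj (G □ K 2) (combine v b) (combine v d)
  □K2-rung = □-adjʳ {G = G} {H = K 2}

  □K2-rail : ∀ {u w} (b : Fin 2) → Adj G u w → Adj (G □ K 2) (combine u b) (combine w b)
  □K2-rail = □-adjˡ {G = G} {H = K 2}

  independent⇒atMostOne : ∀ {p} → Independent (G □ K 2) p → AtMostOnePerFibre {n} p
  independent⇒atMostOne ind v {b} {d} vb∈p vd∈p with b ≟ d
  ... | yes b≡d = b≡d
  ... | no  b≢d = contradiction (□K2-rung v b≢d) (ind vb∈p vd∈p)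

  two-holes⇒emptyFibre : ∀ {p v} {b d : Fin 2} → b ≢ d →
    combine v b ∉ p → combine v d ∉ p → HasEmptyFibre {n} p
  two-holes⇒emptyFibre {p} {v} {b} {d} b≢d vb∉p vd∉p = v , λ e → empty e (K2-cover b≢d e)
    where
    empty : ∀ e → e ≡ b ⊎ e ≡ d → combine v e ∉ p
    empty _ (inj₁ refl) = vb∉p
    empty _ (inj₂ refl) = vd∉p

  -- Two adjacent holes either fill a fibre, or lie over an edge ac of G with the same side b;
  -- the cells over a and c on the other side are then adjacent, so one of them is a hole too.
  adjacent-holes⇒emptyFibre : ∀ {p x y} → Independent (G □ K 2) p → Adj (G □ K 2) x y →
    x ∉ p → y ∉ p → HasEmptyFibre {n} p
  adjacent-holes⇒emptyFibre {p} {x} {y} ind xy x∉p y∉p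
    with pair-view {n} {2} x | pair-view {n} {2} y
  ... | pair a b | pair c d with □-adj-cases {G = G} {H = K 2} xy
  ... | inj₁ (refl , b≢d) = two-holes⇒emptyFibre b≢d x∉p y∉p
  ... | inj₂ (ac , refl) with K2-other b
  ... | e , b≢e with combine a e ∈? p
  ... | no  ae∉p = two-holes⇒emptyFibre b≢e x∉p ae∉p
  ... | yes ae∈p = two-holes⇒emptyFibre b≢e y∉p (λ ce∈p → ind ae∈p ce∈p (□K2-rail e ac))

ProperSides : ∀ {n} → Graph n → (Fin n → Fin 2) → Set
ProperSides G side = ∀ {u v} → Adj G u v → side u ≢ side v

bipartite⇒properSides : ∀ {n} {G : Graph n} → Bipartite G → ∃ (ProperSides G)
bipartite⇒properSides (colour , proper) = from ∘ colour , λ uv → proper uv ∘ from-injective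
  where
  open Inverse 2↔Bool using (to; from; strictlyInverseˡ)
  from-injective : ∀ {a b} → from a ≡ from b → a ≡ b
  from-injective {a} {b} e = trans (sym (strictlyInverseˡ a)) (trans (cong to e) (strictlyInverseˡ b))

module _ {n} (side : Fin n → Fin 2) where

  onSide : Fin n → Fin 2 → Side
  onSide v b = does (b ≟ side v)

  onSide-≡ : ∀ {v b} → b ≡ side v → onSide v b ≡ inside
  onSide-≡ {v} {b} = dec-true (b ≟ side v)

  onSide-≢ : ∀ {v b} → b ≢ side v → onSide v b ≡ outside
  onSide-≢ {v} {b} = dec-false (b ≟ side v)

  checkerboard : Subset (n * 2)
  checkerboard = cells onSide

  ∈checkerboard⇒side : ∀ {v b} → combine v b ∈ checkerboard → b ≡ side v
  ∈checkerboard⇒side {v} {b} vb∈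
    with b ≟ side v | trans (sym ([]=⇒lookup vb∈)) (lookup-cells onSide v b)
  ... | yes b≡ | _  = b≡
  ... | no  _  | ()

  checkerboard-meetsEvery : MeetsEveryFibre {n} checkerboard
  checkerboard-meetsEvery v =
    side v , lookup⇒[]= _ checkerboard (trans (lookup-cells onSide v (side v)) (onSide-≡ refl))

module _ {n} {G : Graph n} {side : Fin n → Fin 2} (proper : ProperSides G side) where

  checkerboard-independent : Independent (G □ K 2) (checkerboard side)
  checkerboard-independent {x} {y} x∈ y∈ xy with pair-view {n} {2} x | pair-view {n} {2} y
  ... | pair a b | pair c d
    with □-adj-cases {G = G} {H = K 2} xy | ∈checkerboard⇒side side x∈ | ∈checkerboard⇒side side y∈
  ... | inj₁ (refl , b≢d) | refl | refl = b≢d refl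
  ... | inj₂ (ac , refl)  | refl | e    = proper ac e

  □K2-independenceNumber : IsIndependenceNumber (G □ K 2) n
  □K2-independenceNumber =
    (checkerboard side , checkerboard-independent ,
     ≤-antisym (bound checkerboard-independent) (meetsEvery⇒n≤∣p∣ _ (checkerboard-meetsEvery side))) ,
    λ _ → bound
    where
    bound : ∀ {S} → Independent (G □ K 2) S → ∣ S ∣ ≤ n
    bound ind = atMostOne⇒∣p∣≤n _ (independent⇒atMostOne G ind)

independenceNumber-unique : ∀ {N} {H : Graph N} {a b} →
  IsIndependenceNumber H a → IsIndependenceNumber H b → a ≡ b
independenceNumber-unique ((S , indS , refl) , maxA) ((T , indT , refl) , maxB) =
  ≤-antisym (maxB S indS) (maxA T indT)

□K2-∣terminal∣≤n∸1 : ∀ {m} {G : Graph (suc (suc m))} → Connected G →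
  ∀ T → TerminalState (G □ K 2) T → ∣ T ∣ ≤ suc m
□K2-∣terminal∣≤n∸1 {m} {G} conn T terminal@((h , play) , _)
  with terminal⇒independent (□-connected {G = G} {H = K 2} conn (K-connected 2)) terminal
     | ε-or-last play
... | ind | inj₁ refl = contradiction (atMostOne⇒∣p∣≤n _ (independent⇒atMostOne G ind)) start-too-big
  where
  start-too-big : ¬ ∣ ∁ ⁅ h ⁆ ∣ ≤ suc (suc m)
  start-too-big = <⇒≱ (s≤s (s≤s (s≤s (m≤m*n m 2)))) ∘ subst (_≤ suc (suc m)) (∣∁⁅x⁆∣≡n∸1 h)
... | ind | inj₂ (_ , j) =
  let (_ , _ , xy , x∉T , y∉T) = jump-vacates j in
  s≤s⁻¹ (atMostOne∧empty⇒∣p∣<n T (independent⇒atMostOne G ind)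
                                  (adjacent-holes⇒emptyFibre G ind xy x∉T y∉T))

-- The cell at path position i in stage k of the construction, where s tells whether the cell
-- lies on the checkerboard: before k only checkerboard cells hold pegs, the fibre at k is empty,
-- and every fibre after k is still full.
stageCell : ℕ → ℕ → Side → Side
stageCell zero    zero    _ = outside
stageCell zero    (suc _) _ = inside
stageCell (suc k) zero    s = s
stageCell (suc k) (suc i) s = stageCell k i s

stageCell-< : ∀ {k i} s → i < k → stageCell k i s ≡ s
stageCell-< {suc k} {zero}  s _         = refl
stageCell-< {suc k} {suc i} s (s≤s i<k) = stageCell-< s i<k

stageCell-≡ : ∀ k s → stageCell k k s ≡ outside
stageCell-≡ zero    s = refl
stageCell-≡ (suc k) s = stageCell-≡ k s

stageCell-> : ∀ {k i} s → k < i → stageCell k i s ≡ inside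
stageCell-> {zero}  {suc i} s _         = refl
stageCell-> {suc k} {suc i} s (s≤s k<i) = stageCell-> s k<i

stageCell-suc : ∀ {k i} s → i ≢ k → i ≢ suc k → stageCell (suc k) i s ≡ stageCell k i s
stageCell-suc {zero}  {zero}        s i≢0 _   = contradiction refl i≢0
stageCell-suc {zero}  {suc zero}    s _   i≢1 = contradiction refl i≢1
stageCell-suc {zero}  {suc (suc i)} s _   _   = refl
stageCell-suc {suc k} {zero}        s _   _   = refl
stageCell-suc {suc k} {suc i}       s i≢k i≢sk = stageCell-suc s (i≢k ∘ cong suc) (i≢sk ∘ cong suc)

stageCell-inside : ∀ {k i} s → i ≤ k → stageCell k i s ≡ inside → s ≡ inside
stageCell-inside {zero}  {zero}  s _         ()
stageCell-inside {suc k} {zero}  s _         eq = eq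
stageCell-inside {suc k} {suc i} s (s≤s i≤k) eq = stageCell-inside s i≤k eq

module Construction {m} {G : Graph (suc (suc m))} {side} (proper : ProperSides G side)
  (σ : Permutation′ (suc (suc m)))
  (path : ∀ i j → toℕ j ≡ suc (toℕ i) → Adj G (σ ⟨$⟩ʳ i) (σ ⟨$⟩ʳ j)) where

  private
    n : ℕ
    n = suc (suc m)

  position : Fin n → ℕ
  position v = toℕ (σ ⟨$⟩ˡ v)

  position-injective : ∀ {u v} → position u ≡ position v → u ≡ v
  position-injective e =
    trans (sym (inverseʳ σ)) (trans (cong (σ ⟨$⟩ʳ_) (toℕ-injective e)) (inverseʳ σ))

  consecutive : ∀ k → suc k < n → ∃₂ λ u w → position u ≡ k × position w ≡ suc k × Adj G u w
  consecutive k k+1<n =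
    σ ⟨$⟩ʳ i , σ ⟨$⟩ʳ j , position-at k<n , position-at k+1<n ,
    path i j (trans (toℕ-fromℕ< k+1<n) (cong suc (sym (toℕ-fromℕ< k<n))))
    where
    k<n : k < n
    k<n = ≤-trans (n≤1+n (suc k)) k+1<n
    i j : Fin n
    i = fromℕ< k<n
    j = fromℕ< k+1<n
    position-at : ∀ {l} .(l<n : l < n) → position (σ ⟨$⟩ʳ fromℕ< l<n) ≡ l
    position-at l<n = trans (cong toℕ (inverseˡ σ)) (toℕ-fromℕ< l<n)

  position≢ : ∀ {u v k} → v ≢ u → position u ≡ k → position v ≢ k
  position≢ v≢u pu pv = v≢u (position-injective (trans pv (sym pu)))

  onStage : ℕ → Fin n → Fin 2 → Side
  onStage k v b = stageCell k (position v) (onSide side v b)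

  stage : ℕ → Subset (n * 2)
  stage k = cells (onStage k)

  stage-at : ∀ k {v b i s} → position v ≡ i → onSide side v b ≡ s →
    lookup (stage k) (combine v b) ≡ stageCell k i s
  stage-at k {v} {b} refl refl = lookup-cells (onStage k) v b

  stage-jump : ∀ k → suc k < n → Jump (G □ K 2) (stage k) (stage (suc k))
  stage-jump k k+1<n with consecutive k k+1<n
  ... | u , w , pu , pw , uw =
    jump-intro {H = G □ K 2} (□K2-rung G w sw≢su) (□K2-rail G (side u) (adj-sym G uw)) (combine-≢ˡ w≢u)
      (trans (stage-at k pw (onSide-≡ side refl)) (stageCell-> inside (n<1+n k)))
      (trans (stage-at k pw (onSide-≢ side su≢sw)) (stageCell-> outside (n<1+n k)))
      (trans (stage-at k pu (onSide-≡ side refl)) (stageCell-≡ k inside))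
      (trans (stage-at (suc k) pw (onSide-≡ side refl)) (stageCell-≡ (suc k) inside))
      (trans (stage-at (suc k) pw (onSide-≢ side su≢sw)) (stageCell-≡ (suc k) outside))
      (trans (stage-at (suc k) pu (onSide-≡ side refl)) (stageCell-< inside (n<1+n k)))
      unchanged
    where
    su≢sw : side u ≢ side w
    su≢sw = proper uw
    sw≢su : side w ≢ side u
    sw≢su = su≢sw ∘ sym
    w≢u : w ≢ u
    w≢u = adj⇒≢ G uw ∘ sym
    X Y Z : Fin (n * 2)
    X = combine w (side w)
    Y = combine w (side u)
    Z = combine u (side u)
    unchanged : ∀ x → x ≢ X → x ≢ Y → x ≢ Z → lookup (stage (suc k)) x ≡ lookup (stage k) x
    unchanged x x≢X x≢Y x≢Z with pair-view {n} {2} x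
    ... | pair v b with v ≟ u | v ≟ w
    ... | yes refl | _ = begin
      lookup (stage (suc k)) (combine u b) ≡⟨ stage-at (suc k) pu (onSide-≢ side b≢su) ⟩
      stageCell (suc k) k outside          ≡⟨ stageCell-< outside (n<1+n k) ⟩
      outside                              ≡⟨ stageCell-≡ k outside ⟨
      stageCell k k outside                ≡⟨ stage-at k pu (onSide-≢ side b≢su) ⟨
      lookup (stage k) (combine u b)       ∎
      where
      open ≡-Reasoning
      b≢su : b ≢ side u
      b≢su = x≢Z ∘ cong (combine u)
    ... | no _ | yes refl with K2-cover su≢sw b
    ... | inj₁ refl = contradiction refl x≢Y
    ... | inj₂ refl = contradiction refl x≢X
    unchanged x x≢X x≢Y x≢Z | pair v b | no v≢u | no v≢w =
      trans (stage-at (suc k) refl refl)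
        (trans (stageCell-suc _ (position≢ v≢u pu) (position≢ v≢w pw)) (sym (stage-at k refl refl)))

  -- The hole starts at (u , side w), opposite the checkerboard cell of the first path vertex u.
  opening : ∃₂ λ h T → Jump (G □ K 2) (∁ ⁅ h ⁆) T × Jump (G □ K 2) T (stage 1)
  opening with consecutive 0 (s≤s (s≤s z≤n))
  ... | u , w , pu , pw , uw = h , T₁ , first , second
    where
    su≢sw : side u ≢ side w
    su≢sw = proper uw
    sw≢su : side w ≢ side u
    sw≢su = su≢sw ∘ sym
    w≢u : w ≢ u
    w≢u = adj⇒≢ G uw ∘ sym
    h X₁ Y₁ X₂ : Fin (n * 2)
    h  = combine u (side w)
    X₁ = combine w (side u)
    Y₁ = combine u (side u)
    X₂ = combine w (side w)
    start T₁ : Subset (n * 2)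
    start = ∁ ⁅ h ⁆
    T₁ = jumped start X₁ Y₁ h

    X₁≢h : X₁ ≢ h
    X₁≢h = combine-≢ˡ w≢u
    Y₁≢h : Y₁ ≢ h
    Y₁≢h = combine-≢ʳ u su≢sw
    X₁≢Y₁ : X₁ ≢ Y₁
    X₁≢Y₁ = combine-≢ˡ w≢u

    first : Jump (G □ K 2) start T₁
    first = jump X₁ Y₁ h (□K2-rail G (side u) (adj-sym G uw)) (□K2-rung G u su≢sw) X₁≢h
      (x≢y⇒x∈∁⁅y⁆ X₁≢h) (x≢y⇒x∈∁⁅y⁆ Y₁≢h) (x∉∁⁅x⁆ h)

    T₁-elsewhere : ∀ {x} → x ≢ X₁ → x ≢ Y₁ → x ≢ h → lookup T₁ x ≡ inside
    T₁-elsewhere x≢X₁ x≢Y₁ x≢h =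
      trans (lookup-jumped-other start X₁ Y₁ h x≢X₁ x≢Y₁ x≢h) ([]=⇒lookup (x≢y⇒x∈∁⁅y⁆ x≢h))

    second : Jump (G □ K 2) T₁ (stage 1)
    second =
      jump-intro {H = G □ K 2} (□K2-rail G (side w) (adj-sym G uw)) (□K2-rung G u sw≢su) (combine-≢ˡ w≢u)
        (T₁-elsewhere (combine-≢ʳ w sw≢su) (combine-≢ˡ w≢u) (combine-≢ˡ w≢u))
        (lookup-jumped-z start X₁ Y₁ h)
        (lookup-jumped-y start X₁ Y₁ h Y₁≢h)
        (stage-at 1 pw (onSide-≡ side refl))
        (stage-at 1 pu (onSide-≢ side sw≢su))
        (stage-at 1 pu (onSide-≡ side refl))
        unchanged
      where
      unchanged : ∀ x → x ≢ X₂ → x ≢ h → x ≢ Y₁ → lookup (stage 1) x ≡ lookup T₁ x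
      unchanged x x≢X₂ x≢h x≢Y₁ with pair-view {n} {2} x
      ... | pair v b with v ≟ u | v ≟ w | K2-cover su≢sw b
      ... | yes refl | _        | inj₁ refl = contradiction refl x≢Y₁
      ... | yes refl | _        | inj₂ refl = contradiction refl x≢h
      ... | no _     | yes refl | inj₁ refl =
        trans (stage-at 1 pw (onSide-≢ side su≢sw)) (sym (lookup-jumped-x start X₁ Y₁ h X₁≢Y₁ X₁≢h))
      ... | no _     | yes refl | inj₂ refl = contradiction refl x≢X₂
      ... | no v≢u   | no v≢w   | _         =
        trans (stage-at 1 refl refl)
          (trans (stageCell-> _ 1<position)
            (sym (T₁-elsewhere (combine-≢ˡ v≢w) (combine-≢ˡ v≢u) (combine-≢ˡ v≢u))))
        where
        1<position : 1 < position v
        1<position = ≤∧≢⇒< (n≢0⇒n>0 (position≢ v≢u pu)) (position≢ v≢w pw ∘ sym)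

  hole : Fin (n * 2)
  hole = proj₁ opening

  reach : ∀ k → suc k < n →
    Star (Jump (G □ K 2)) (∁ ⁅ hole ⁆) (stage (suc k)) × suc (suc k) + ∣ stage (suc k) ∣ ≡ ∣ ∁ ⁅ hole ⁆ ∣
  reach zero _ =
    let (_ , j₁ , j₂) = proj₂ opening in
    j₁ ◅ j₂ ◅ ε , trans (cong suc (jump-size j₂)) (jump-size j₁)
  reach (suc k) k+2<n =
    let (play , count) = reach k (≤-trans (n≤1+n _) k+2<n)
        j = stage-jump (suc k) k+2<n
    in
    play ◅◅ j ◅ ε , (begin
      suc (suc (suc k)) + ∣ stage (suc (suc k)) ∣ ≡⟨ +-suc (suc (suc k)) _ ⟨
      suc (suc k) + suc ∣ stage (suc (suc k)) ∣   ≡⟨ cong (suc (suc k) +_) (jump-size j) ⟩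
      suc (suc k) + ∣ stage (suc k) ∣             ≡⟨ count ⟩
      ∣ ∁ ⁅ hole ⁆ ∣                               ∎)
    where open ≡-Reasoning

  final : Subset (n * 2)
  final = stage (suc m)

  final⊆checkerboard : final ⊆ checkerboard side
  final⊆checkerboard {x} x∈final with pair-view {n} {2} x
  ... | pair v b = lookup⇒[]= _ _ (trans (lookup-cells (onSide side) v b)
    (stageCell-inside _ (s≤s⁻¹ (toℕ<n (σ ⟨$⟩ˡ v)))
      (trans (sym (stage-at (suc m) refl refl)) ([]=⇒lookup x∈final))))

  final-independent : Independent (G □ K 2) final
  final-independent x∈ y∈ =
    checkerboard-independent {G = G} proper (final⊆checkerboard x∈) (final⊆checkerboard y∈)

  final-terminal : TerminalState (G □ K 2) final
  final-terminal = (hole , proj₁ (reach m ≤-refl)) , independent⇒noJump final-independent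

  ∣final∣ : ∣ final ∣ ≡ suc m
  ∣final∣ =
    +-cancelˡ-≡ (suc (suc m)) _ _ (trans (proj₂ (reach m ≤-refl)) (trans (∣∁⁅x⁆∣≡n∸1 hole) (double m)))
    where
    double : ∀ k → suc (suc (suc (k * 2))) ≡ suc (suc k) + suc k
    double = solve-∀

□K2-foolsSolitaireNumber : ∀ {m} {G : Graph (suc (suc m))} {side} →
  Connected G → ProperSides G side → HasHamiltonianPath G → IsFoolsSolitaireNumber (G □ K 2) (suc m)
□K2-foolsSolitaireNumber {G = G} conn proper (σ , path) =
  (final , final-terminal , ∣final∣) , □K2-∣terminal∣≤n∸1 conn
  where open Construction {G = G} proper σ path

corollary3p7 : ∀ {n : ℕ} (G : Graph n) → 2 ≤ n → Connected G → Bipartite G →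
    HasHamiltonianPath G → ∀ (a : ℕ) → IsIndependenceNumber (G □ K 2) a →
    IsFoolsSolitaireNumber (G □ K 2) (a ∸ 1)
corollary3p7 {suc (suc m)} G (s≤s (s≤s z≤n)) conn bipartite hamiltonian a α =
  subst (λ k → IsFoolsSolitaireNumber (G □ K 2) (k ∸ 1)) n≡a
    (□K2-foolsSolitaireNumber conn proper hamiltonian)
  where
  side : Fin (suc (suc m)) → Fin 2
  side = proj₁ (bipartite⇒properSides {G = G} bipartite)
  proper : ProperSides G side
  proper = proj₂ (bipartite⇒properSides {G = G} bipartite)
  n≡a : suc (suc m) ≡ a
  n≡a = independenceNumber-unique {H = G □ K 2} (□K2-independenceNumber {G = G} proper) α
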